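{- Let $P(r)=a_kr^k+\cdots+a_1r+a_0$ with $k\geq1$, each $a_j\in\mathbb{Z}$ and $a_k>0$. If $N$ is sufficiently large (depending on $P$) and $A\subseteq[1,N]$ satisfies \[\frac{|A|}{N}\geq 4a_k^{1/k}\,N^{ -1/k},\] then there exist $r',r''\in\mathbb{N}$ with $r'\neq r''$ such that \[P(r')-P(r'')\in A-A.\]
   Context: $[1,N]=\{1,2,\dots,N\}$; $A-A=\{a-a':a,a'\in A\}$. -}

module Defs where

open import Data.Nat using (ℕ; zero; suc)
open import Data.Fin using (Fin; zero; suc)
open import Data.Integer using (ℤ; _+_; _*_; _^_; 0ℤ)

polyEval : (n : ℕ) → (Fin n → ℤ) → ℤ → ℤ
polyEval zero    a x = 0ℤ
polyEval (suc n) a x = a zero + x * polyEval n (λ j → a (suc j)) x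

{-# OPTIONS --safe #-}
-- Write c = a_k and m = |A|, and put R = ⌊2N/m⌋. The density hypothesis gives
-- 2^k c R^k ≤ N, and on [1, R] the lower-order part of P is bounded by
-- E = (Σ_{j<k} |a_j|) R^{k-1}. So the R translates A + P(r) + E, 1 ≤ r ≤ R,
-- all lie in [0, N + c R^k + 2E], an interval shorter than R m once N is large.
-- Two of the translates therefore meet: x + P(r′) = y + P(r″) with r′ ≠ r″.
module Submission where

module TranslatePigeonhole where

  open import Data.Nat using (ℕ; suc; _≤_; _<_; _+_; _*_; z≤n; s≤s)
  open import Data.Nat.Properties using (_≟_; +-cancelʳ-≡; suc-injective; <⇒≱)
  open import Data.List using (List; []; _∷_; _++_; length; map; upTo; cartesianProductWith)
  open import Data.List.Properties using (length-++; length-map; length-upTo; length-removeAt′)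
  open import Data.List.Membership.Propositional using (_∈_; find; lose)
  open import Data.List.Membership.Propositional.Properties
    using (∈-map⁻; ∈-map⁺; ∈-upTo⁺; ∈-upTo⁻; ∈-cartesianProductWith⁻)
  open import Data.List.Relation.Binary.Subset.Propositional using (_⊆_)
  open import Data.List.Relation.Unary.All as All using (All)
  open import Data.List.Relation.Unary.Any using (here; there; any?; index; _─_)
  open import Data.List.Relation.Unary.AllPairs using ([]; _∷_)
  open import Data.List.Relation.Unary.Unique.Propositional using (Unique)
  import Data.List.Relation.Unary.Unique.Propositional.Properties as Unique
  open import Data.Product using (_×_; _,_)
  open import Data.Sum using (_⊎_; inj₁; inj₂)
  open import Data.Empty using (⊥-elim)
  open import Relation.Nullary using (¬_; yes; no; contradiction)
  open import Relation.Binary.PropositionalEquality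

  ∈-─⁺ : ∀ {A : Set} {v w : A} {ys} (v∈ys : v ∈ ys) → w ∈ ys → w ≢ v → w ∈ (ys ─ v∈ys)
  ∈-─⁺ (here refl) (here refl) w≢v = ⊥-elim (w≢v refl)
  ∈-─⁺ (here refl) (there w∈ys) _ = w∈ys
  ∈-─⁺ (there v∈ys) (here refl) _ = here refl
  ∈-─⁺ (there v∈ys) (there w∈ys) w≢v = there (∈-─⁺ v∈ys w∈ys w≢v)

  Unique-⊆⇒length≤ : ∀ {A : Set} {xs ys : List A} → Unique xs → xs ⊆ ys → length xs ≤ length ys
  Unique-⊆⇒length≤ {xs = []} _ _ = z≤n
  Unique-⊆⇒length≤ {xs = x ∷ xs} {ys} (x∉xs ∷ xs!) xs⊆ys =
    subst (suc (length xs) ≤_) (sym (length-removeAt′ ys (index x∈ys)))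
      (s≤s (Unique-⊆⇒length≤ xs! xs⊆ys─x))
    where
    x∈ys = xs⊆ys (here refl)
    xs⊆ys─x : xs ⊆ (ys ─ x∈ys)
    xs⊆ys─x v∈xs = ∈-─⁺ x∈ys (xs⊆ys (there v∈xs)) (λ v≡x → All.lookup x∉xs v∈xs (sym v≡x))

  length-cartesianProductWith : ∀ {A B C : Set} (f : A → B → C) xs ys →
    length (cartesianProductWith f xs ys) ≡ length xs * length ys
  length-cartesianProductWith f [] ys = refl
  length-cartesianProductWith f (x ∷ xs) ys = begin
    length (map (f x) ys ++ cartesianProductWith f xs ys)
      ≡⟨ length-++ (map (f x) ys) ⟩
    length (map (f x) ys) + length (cartesianProductWith f xs ys)
      ≡⟨ cong₂ _+_ (length-map (f x) ys) (length-cartesianProductWith f xs ys) ⟩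
    length ys + length xs * length ys ∎
    where open ≡-Reasoning

  [1…_] : ℕ → List ℕ
  [1… n ] = map suc (upTo n)

  [1…]-Unique : ∀ n → Unique [1… n ]
  [1…]-Unique n = Unique.map⁺ suc-injective (Unique.upTo⁺ n)

  length-[1…] : ∀ n → length [1… n ] ≡ n
  length-[1…] n = trans (length-map suc (upTo n)) (length-upTo n)

  ∈-[1…]⁺ : ∀ {n x} → 1 ≤ x × x ≤ n → x ∈ [1… n ]
  ∈-[1…]⁺ {x = suc x} (_ , x<n) = ∈-map⁺ suc (∈-upTo⁺ x<n)

  ∈-[1…]⁻ : ∀ {n x} → x ∈ [1… n ] → 1 ≤ x × x ≤ n
  ∈-[1…]⁻ x∈ with ∈-map⁻ suc x∈
  ... | i , i∈ , refl = s≤s z≤n , ∈-upTo⁻ i∈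

  Unique∧⊆[1…N]⇒length≤N : ∀ {N} {A : List ℕ} → Unique A → All (λ x → 1 ≤ x × x ≤ N) A → length A ≤ N
  Unique∧⊆[1…N]⇒length≤N {N} A! A⊆[1…N] =
    subst (_ ≤_) (length-[1…] N) (Unique-⊆⇒length≤ A! (λ x∈A → ∈-[1…]⁺ (All.lookup A⊆[1…N] x∈A)))

  record TranslatesMeet (A : List ℕ) (t : ℕ → ℕ) (rs : List ℕ) : Set where
    constructor meet
    field
      {r′ r″ x y} : ℕ
      r′∈rs : r′ ∈ rs
      r″∈rs : r″ ∈ rs
      r′≢r″ : r′ ≢ r″
      x∈A : x ∈ A
      y∈A : y ∈ A
      x+t[r′]≡y+t[r″] : x + t r′ ≡ y + t r″

  module _ (A : List ℕ) (t : ℕ → ℕ) where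

    translates : List ℕ → List ℕ
    translates rs = cartesianProductWith (λ r x → x + t r) rs A

    translatesMeet-or-Unique : Unique A → ∀ {rs} → Unique rs → TranslatesMeet A t rs ⊎ Unique (translates rs)
    translatesMeet-or-Unique A! {[]} [] = inj₂ []
    translatesMeet-or-Unique A! {r ∷ rs} (r∉rs ∷ rs!) with translatesMeet-or-Unique A! rs!
    ... | inj₁ (meet r′∈rs r″∈rs r′≢r″ x∈A y∈A eq) = inj₁ (meet (there r′∈rs) (there r″∈rs) r′≢r″ x∈A y∈A eq)
    ... | inj₂ rest! with any? (λ x → any? (λ r″ → any? (λ y → x + t r ≟ y + t r″) A) rs) A
    ... | yes hit =
          let x , x∈A , hit′ = find hit
              r″ , r″∈rs , hit″ = find hit′
              y , y∈A , eq = find hit″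
          in inj₁ (meet (here refl) (there r″∈rs) (All.lookup r∉rs r″∈rs) x∈A y∈A eq)
    ... | no miss = inj₂ (Unique.++⁺ (Unique.map⁺ (+-cancelʳ-≡ _ _ _) A!) rest! disjoint)
      where
      disjoint : ∀ {v} → ¬ (v ∈ map (_+ t r) A × v ∈ translates rs)
      disjoint (v∈Ar , v∈rest) with ∈-map⁻ (_+ t r) v∈Ar | ∈-cartesianProductWith⁻ (λ r x → x + t r) rs A v∈rest
      ... | x , x∈A , refl | r″ , y , r″∈rs , y∈A , eq = miss (lose x∈A (lose r″∈rs (lose y∈A eq)))

    translatesMeet : ∀ {rs S} → Unique A → Unique rs →
      (∀ {r x} → r ∈ rs → x ∈ A → x + t r < S) → S < length rs * length A → TranslatesMeet A t rs
    translatesMeet {rs} {S} A! rs! bounded crowded with translatesMeet-or-Unique A! rs!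
    ... | inj₁ hit = hit
    ... | inj₂ spread! = contradiction
      (subst₂ _≤_ (length-cartesianProductWith _ rs A) (length-upTo S)
        (Unique-⊆⇒length≤ spread! translates⊆upTo))
      (<⇒≱ crowded)
      where
      translates⊆upTo : translates rs ⊆ upTo S
      translates⊆upTo v∈ with ∈-cartesianProductWith⁻ (λ r x → x + t r) rs A v∈
      ... | r , x , r∈rs , x∈A , refl = ∈-upTo⁺ (bounded r∈rs x∈A)

module LowerOrderTerms where

  open import Defs
  open import Data.Nat as ℕ using (ℕ; zero; suc; z≤n)
  import Data.Nat.Properties as ℕ
  import Data.Nat.Tactic.RingSolver as ℕ-Solver
  open import Data.Fin using (Fin; zero; suc; fromℕ)
  open import Data.Integer using (ℤ; +_; -[1+_]; 0ℤ; _+_; _-_; _*_; _^_; _≤_; ∣_∣; +≤+)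
  open import Data.Integer.Properties using (pos-*; abs-*; ∣i+j∣≤∣i∣+∣j∣; ⊖-≥; +-mono-≤)
  open import Data.Integer.Tactic.RingSolver using (solve-∀)
  open import Function using (_∘_)
  open import Relation.Binary.PropositionalEquality

  pos-^ : ∀ m n → (+ m) ^ n ≡ + (m ℕ.^ n)
  pos-^ m zero = refl
  pos-^ m (suc n) = trans (cong (+ m *_) (pos-^ m n)) (sym (pos-* m (m ℕ.^ n)))

  lowerCoeffNorm : (n : ℕ) → (Fin (suc n) → ℤ) → ℕ
  lowerCoeffNorm zero a = 0
  lowerCoeffNorm (suc n) a = ∣ a zero ∣ ℕ.+ lowerCoeffNorm n (a ∘ suc)

  lowerTerms : (n : ℕ) → (Fin (suc n) → ℤ) → ℕ → ℤ
  lowerTerms n a r = polyEval (suc n) a (+ r) - a (fromℕ n) * (+ r) ^ n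

  lowerTerms-zero : ∀ a r → lowerTerms zero a r ≡ 0ℤ
  lowerTerms-zero a r = identity (a zero) (+ r)
    where
    identity : ∀ a₀ x → a₀ + x * 0ℤ - a₀ * + 1 ≡ 0ℤ
    identity = solve-∀

  lowerTerms-suc : ∀ n a r → lowerTerms (suc n) a r ≡ a zero + + r * lowerTerms n (a ∘ suc) r
  lowerTerms-suc n a r =
    identity (a zero) (+ r) (polyEval (suc n) (a ∘ suc) (+ r)) (a (fromℕ (suc n))) ((+ r) ^ n)
    where
    identity : ∀ a₀ x p c y → a₀ + x * p - c * (x * y) ≡ a₀ + x * (p - c * y)
    identity = solve-∀

  lowerTerms-bound : ∀ n a r → r ℕ.* ∣ lowerTerms n a r ∣ ℕ.≤ lowerCoeffNorm n a ℕ.* r ℕ.^ n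
  lowerTerms-bound zero a r rewrite lowerTerms-zero a r | ℕ.*-zeroʳ r = z≤n
  lowerTerms-bound (suc n) a r = begin
    r ℕ.* ∣ lowerTerms (suc n) a r ∣        ≡⟨ cong (λ T → r ℕ.* ∣ T ∣) (lowerTerms-suc n a r) ⟩
    r ℕ.* ∣ a zero + + r * T ∣              ≤⟨ ℕ.*-monoʳ-≤ r (∣i+j∣≤∣i∣+∣j∣ (a zero) (+ r * T)) ⟩
    r ℕ.* (∣ a zero ∣ ℕ.+ ∣ + r * T ∣)      ≡⟨ cong (λ z → r ℕ.* (∣ a zero ∣ ℕ.+ z)) (abs-* (+ r) T) ⟩
    r ℕ.* (∣ a zero ∣ ℕ.+ r ℕ.* ∣ T ∣)      ≡⟨ ℕ.*-distribˡ-+ r ∣ a zero ∣ (r ℕ.* ∣ T ∣) ⟩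
    r ℕ.* ∣ a zero ∣ ℕ.+ r ℕ.* (r ℕ.* ∣ T ∣) ≤⟨ ℕ.+-mono-≤ (r*a≤a*r^[1+n]) (ℕ.*-monoʳ-≤ r (lowerTerms-bound n (a ∘ suc) r)) ⟩
    ∣ a zero ∣ ℕ.* r ℕ.^ suc n ℕ.+ r ℕ.* (B ℕ.* r ℕ.^ n) ≡⟨ collect ∣ a zero ∣ r B (r ℕ.^ n) ⟩
    lowerCoeffNorm (suc n) a ℕ.* r ℕ.^ suc n ∎
    where
    open ℕ.≤-Reasoning
    T = lowerTerms n (a ∘ suc) r
    B = lowerCoeffNorm n (a ∘ suc)
    r≤r^[1+n] : ∀ r → r ℕ.≤ r ℕ.^ suc n
    r≤r^[1+n] zero = z≤n
    r≤r^[1+n] r@(suc _) = ℕ.m≤m*n r (r ℕ.^ n) {{ℕ.m^n≢0 r n}}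
    r*a≤a*r^[1+n] : r ℕ.* ∣ a zero ∣ ℕ.≤ ∣ a zero ∣ ℕ.* r ℕ.^ suc n
    r*a≤a*r^[1+n] = ℕ.≤-trans (ℕ.≤-reflexive (ℕ.*-comm r ∣ a zero ∣)) (ℕ.*-monoʳ-≤ ∣ a zero ∣ (r≤r^[1+n] r))
    collect : ∀ a r b y → a ℕ.* (r ℕ.* y) ℕ.+ r ℕ.* (b ℕ.* y) ≡ (a ℕ.+ b) ℕ.* (r ℕ.* y)
    collect = ℕ-Solver.solve-∀

  lowerTerms-bound-on-[1…R] : ∀ k a {r R} → 1 ℕ.≤ r → r ℕ.≤ R →
    ∣ lowerTerms (suc k) a r ∣ ℕ.≤ lowerCoeffNorm (suc k) a ℕ.* R ℕ.^ k
  lowerTerms-bound-on-[1…R] k a {r@(suc _)} _ r≤R = ℕ.≤-trans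
    (ℕ.*-cancelˡ-≤ r (subst (r ℕ.* ∣ lowerTerms (suc k) a r ∣ ℕ.≤_) (swap B r (r ℕ.^ k)) (lowerTerms-bound (suc k) a r)))
    (ℕ.*-monoʳ-≤ B (ℕ.^-monoˡ-≤ k r≤R))
    where
    B = lowerCoeffNorm (suc k) a
    swap : ∀ b r y → b ℕ.* (r ℕ.* y) ≡ r ℕ.* (b ℕ.* y)
    swap = ℕ-Solver.solve-∀

  polyEval-split : ∀ n a {c} → a (fromℕ n) ≡ + c → ∀ r →
    polyEval (suc n) a (+ r) ≡ + (c ℕ.* r ℕ.^ n) + lowerTerms n a r
  polyEval-split n a {c} a[n]≡c r = begin
    polyEval (suc n) a (+ r)                                ≡⟨ identity (polyEval (suc n) a (+ r)) (a (fromℕ n) * (+ r) ^ n) ⟩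
    a (fromℕ n) * (+ r) ^ n + lowerTerms n a r               ≡⟨ cong (_+ lowerTerms n a r) (cong₂ _*_ a[n]≡c (pos-^ r n)) ⟩
    + c * + (r ℕ.^ n) + lowerTerms n a r                     ≡⟨ cong (_+ lowerTerms n a r) (sym (pos-* c (r ℕ.^ n))) ⟩
    + (c ℕ.* r ℕ.^ n) + lowerTerms n a r ∎
    where
    open ≡-Reasoning
    identity : ∀ p q → p ≡ q + (p - q)
    identity = solve-∀

  0≤i+E : ∀ i E → ∣ i ∣ ℕ.≤ E → 0ℤ ≤ i + + E
  0≤i+E (+ n) E _ = +≤+ z≤n
  0≤i+E -[1+ n ] E n<E rewrite ⊖-≥ n<E = +≤+ z≤n

  0≤n+[i+E] : ∀ n i E → ∣ i ∣ ℕ.≤ E → 0ℤ ≤ + n + (i + + E)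
  0≤n+[i+E] n i E ∣i∣≤E = +-mono-≤ (+≤+ z≤n) (0≤i+E i E ∣i∣≤E)

  ∣n+[i+E]∣≤n+2E : ∀ n i E → ∣ i ∣ ℕ.≤ E → ∣ + n + (i + + E) ∣ ℕ.≤ n ℕ.+ (E ℕ.+ E)
  ∣n+[i+E]∣≤n+2E n i E ∣i∣≤E = begin
    ∣ + n + (i + + E) ∣       ≤⟨ ∣i+j∣≤∣i∣+∣j∣ (+ n) (i + + E) ⟩
    n ℕ.+ ∣ i + + E ∣         ≤⟨ ℕ.+-monoʳ-≤ n (∣i+j∣≤∣i∣+∣j∣ i (+ E)) ⟩
    n ℕ.+ (∣ i ∣ ℕ.+ E)       ≤⟨ ℕ.+-monoʳ-≤ n (ℕ.+-monoˡ-≤ E ∣i∣≤E) ⟩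
    n ℕ.+ (E ℕ.+ E) ∎
    where open ℕ.≤-Reasoning

module SizeEstimates where

  open import Data.Nat using (ℕ; zero; suc; _≤_; _<_; _+_; _*_; _^_; NonZero; >-nonZero; _≤?_; s≤s; z≤n)
  open import Data.Nat.Properties
  open import Data.Nat.DivMod using (_/_; m≡m%n+[m/n]*n; m%n<n; m*n/n≡m; /-monoˡ-≤)
  open import Data.Nat.Tactic.RingSolver using (solve-∀)
  open import Relation.Nullary using (yes; no)
  open import Relation.Binary.PropositionalEquality

  ^-distribʳ-* : ∀ m n o → (m * n) ^ o ≡ m ^ o * n ^ o
  ^-distribʳ-* m n zero = refl
  ^-distribʳ-* m n (suc o) = trans (cong (m * n *_) (^-distribʳ-* m n o)) (interchange m n (m ^ o) (n ^ o))
    where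
    interchange : ∀ m n p q → m * n * (p * q) ≡ m * p * (n * q)
    interchange = solve-∀

  n<m+[n/m]*m : ∀ n m .{{_ : NonZero m}} → n < m + n / m * m
  n<m+[n/m]*m n m = subst (_< m + n / m * m) (sym (m≡m%n+[m/n]*n n m)) (+-monoˡ-< (n / m * m) (m%n<n n m))

  2≤[2*n]/m : ∀ {m n} .{{_ : NonZero m}} → m ≤ n → 2 ≤ 2 * n / m
  2≤[2*n]/m {m} {n} m≤n = subst (_≤ 2 * n / m) (m*n/n≡m 2 m) (/-monoˡ-≤ m (*-monoʳ-≤ 2 m≤n))

  2^k*c*R^k≤N : ∀ k {c N m R} .{{_ : NonZero N}} →
    4 ^ suc k * c * N ^ k ≤ m ^ suc k → R * m ≤ 2 * N → 2 ^ suc k * c * R ^ suc k ≤ N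
  2^k*c*R^k≤N k {c} {N} {m} {R} dense Rm≤2N =
    *-cancelʳ-≤ (P * c * X) N (P * Z) {{m*n≢0 P Z {{m^n≢0 2 (suc k)}} {{m^n≢0 N k}}}} (begin
      P * c * X * (P * Z)  ≡⟨ regroup X P c Z ⟩
      X * (P * P * c * Z)  ≡⟨ cong (λ Q → X * (Q * c * Z)) (^-distribʳ-* 2 2 (suc k)) ⟨
      X * (4 ^ suc k * c * Z) ≤⟨ *-monoʳ-≤ X dense ⟩
      X * m ^ suc k        ≡⟨ ^-distribʳ-* R m (suc k) ⟨
      (R * m) ^ suc k      ≤⟨ ^-monoˡ-≤ (suc k) Rm≤2N ⟩
      (2 * N) ^ suc k      ≡⟨ ^-distribʳ-* 2 N (suc k) ⟩
      P * (N * Z)          ≡⟨ *-comm P (N * Z) ⟩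
      N * Z * P            ≡⟨ *-assoc N Z P ⟩
      N * (Z * P)          ≡⟨ cong (N *_) (*-comm Z P) ⟩
      N * (P * Z)          ∎)
    where
    open ≤-Reasoning
    P = 2 ^ suc k
    X = R ^ suc k
    Z = N ^ k
    regroup : ∀ X P c Z → P * c * X * (P * Z) ≡ X * (P * P * c * Z)
    regroup = solve-∀

  offsetSpan : (k c B R : ℕ) → ℕ
  offsetSpan k c B R = c * R ^ suc k + (B * R ^ k + B * R ^ k)

  threshold : (k c B : ℕ) → ℕ
  threshold k c B = 3 * (1 + (c + 2 * B) * (7 + 4 * B) ^ suc k)

  module _ (k : ℕ) {c B N m R : ℕ} where

    private
      W = R ^ k
      X = R ^ suc k
      E = B * W

    1+N+span<R*m-large : 1 ≤ c → 2 * (c * X) ≤ N → 7 + 4 * B ≤ R → 2 * N < m + R * m →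
      1 + (N + offsetSpan k c B R) < R * m
    1+N+span<R*m-large 1≤c 2cX≤N Q≤R 2N<m+Rm = *-cancelˡ-< 8 _ (R * m) (begin-strict
      8 * (1 + (N + (c * X + (E + E))))      <⟨ m<m+n _ {8} (s≤s z≤n) ⟩
      8 * (1 + (N + (c * X + (E + E)))) + 8  ≡⟨ expand N (c * X) E ⟩
      8 * N + 4 * (2 * (c * X)) + 2 * (8 * E + 8)
        ≤⟨ +-mono-≤ (+-monoʳ-≤ (8 * N) (*-monoʳ-≤ 4 2cX≤N)) (*-monoʳ-≤ 2 8E+8≤N) ⟩
      8 * N + 4 * N + 2 * N                  ≡⟨ collect N ⟩
      7 * (2 * N)                            <⟨ *-monoʳ-< 7 2N<m+Rm ⟩
      7 * (m + R * m)                        ≡⟨ *-distribˡ-+ 7 m (R * m) ⟩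
      7 * m + 7 * (R * m)                    ≤⟨ +-monoˡ-≤ (7 * (R * m)) (*-monoˡ-≤ m 7≤R) ⟩
      R * m + 7 * (R * m)                    ≡⟨⟩
      8 * (R * m)                            ∎)
      where
      open ≤-Reasoning
      7≤R : 7 ≤ R
      7≤R = ≤-trans (m≤m+n 7 (4 * B)) Q≤R
      spread : ∀ B W → 8 * (B * W) + 8 * W + 6 * W ≡ 2 * ((7 + 4 * B) * W)
      spread = solve-∀
      8E+8≤N : 8 * E + 8 ≤ N
      8E+8≤N = begin
        8 * E + 8                    ≤⟨ +-monoʳ-≤ (8 * E) (*-monoʳ-≤ 8 (m^n>0 R {{>-nonZero (≤-trans (s≤s z≤n) 7≤R)}} k)) ⟩
        8 * E + 8 * W                ≤⟨ m≤m+n (8 * E + 8 * W) (6 * W) ⟩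
        8 * E + 8 * W + 6 * W        ≡⟨ spread B W ⟩
        2 * ((7 + 4 * B) * W)        ≤⟨ *-monoʳ-≤ 2 (*-monoˡ-≤ W Q≤R) ⟩
        2 * X                        ≤⟨ *-monoʳ-≤ 2 (m≤n*m X c {{>-nonZero 1≤c}}) ⟩
        2 * (c * X)                  ≤⟨ 2cX≤N ⟩
        N                            ∎
      expand : ∀ N cX E → 8 * (1 + (N + (cX + (E + E)))) + 8 ≡ 8 * N + 4 * (2 * cX) + 2 * (8 * E + 8)
      expand = solve-∀
      collect : ∀ N → 8 * N + 4 * N + 2 * N ≡ 7 * (2 * N)
      collect = solve-∀

    1+N+span<R*m-small : 2 ≤ R → R ≤ 7 + 4 * B → threshold k c B ≤ N → 2 * N < m + R * m →
      1 + (N + offsetSpan k c B R) < R * m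
    1+N+span<R*m-small 2≤R R≤Q N₀≤N 2N<m+Rm = *-cancelˡ-< 3 _ (R * m) (begin-strict
      3 * (1 + (N + offsetSpan k c B R))     ≡⟨ expand N (offsetSpan k c B R) ⟩
      3 * N + 3 * (1 + offsetSpan k c B R)   ≤⟨ +-monoʳ-≤ (3 * N) (*-monoʳ-≤ 3 (+-monoʳ-≤ 1 span≤C)) ⟩
      3 * N + threshold k c B                ≤⟨ +-monoʳ-≤ (3 * N) N₀≤N ⟩
      3 * N + N                              ≡⟨ collect N ⟩
      2 * (2 * N)                            <⟨ *-monoʳ-< 2 2N<m+Rm ⟩
      2 * (m + R * m)                        ≡⟨ *-distribˡ-+ 2 m (R * m) ⟩
      2 * m + 2 * (R * m)                    ≤⟨ +-monoˡ-≤ (2 * (R * m)) (*-monoˡ-≤ m 2≤R) ⟩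
      R * m + 2 * (R * m)                    ≡⟨⟩
      3 * (R * m)                            ∎)
      where
      open ≤-Reasoning
      Q = 7 + 4 * B
      W≤Q^[1+k] : W ≤ Q ^ suc k
      W≤Q^[1+k] = ≤-trans (^-monoˡ-≤ k R≤Q) (m≤n*m (Q ^ k) Q)
      double : ∀ c B X W → c * X + (B * W + B * W) ≡ c * X + 2 * B * W
      double = solve-∀
      span≤C : offsetSpan k c B R ≤ (c + 2 * B) * Q ^ suc k
      span≤C = begin
        c * X + (E + E)                   ≡⟨ double c B X W ⟩
        c * X + 2 * B * W                 ≤⟨ +-mono-≤ (*-monoʳ-≤ c (^-monoˡ-≤ (suc k) R≤Q)) (*-monoʳ-≤ (2 * B) W≤Q^[1+k]) ⟩
        c * Q ^ suc k + 2 * B * Q ^ suc k ≡⟨ *-distribʳ-+ (Q ^ suc k) c (2 * B) ⟨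
        (c + 2 * B) * Q ^ suc k           ∎
      expand : ∀ N S → 3 * (1 + (N + S)) ≡ 3 * N + 3 * (1 + S)
      expand = solve-∀
      collect : ∀ N → 3 * N + N ≡ 2 * (2 * N)
      collect = solve-∀

  -- Past R = 7 + 4B the error term satisfies 8E + 8 ≤ 2R^(k+1) ≤ N; below it R, hence the
  -- whole span, is bounded by a constant, which is what the threshold absorbs.
  1+N+span<R*m : ∀ k {c B N m R} → 1 ≤ c → 2 ^ suc k * c * R ^ suc k ≤ N → 2 ≤ R → threshold k c B ≤ N →
    2 * N < m + R * m → 1 + (N + offsetSpan k c B R) < R * m
  1+N+span<R*m k {c} {B} {N} {m} {R} 1≤c leading≤N 2≤R N₀≤N 2N<m+Rm with 7 + 4 * B ≤? R
  ... | yes Q≤R = 1+N+span<R*m-large k {c} {B} {N} {m} {R} 1≤c (≤-trans 2cX≤2^k*c*X leading≤N) Q≤R 2N<m+Rm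
    where
    2cX≤2^k*c*X : 2 * (c * R ^ suc k) ≤ 2 ^ suc k * c * R ^ suc k
    2cX≤2^k*c*X = subst (2 * (c * R ^ suc k) ≤_) (regroup (2 ^ k) c (R ^ suc k))
      (*-monoʳ-≤ 2 (m≤n*m (c * R ^ suc k) (2 ^ k) {{m^n≢0 2 k}}))
      where
      regroup : ∀ p c X → 2 * (p * (c * X)) ≡ 2 * p * c * X
      regroup = solve-∀
  ... | no Q≰R = 1+N+span<R*m-small k {c} {B} {N} {m} {R} 2≤R (<⇒≤ (≰⇒> Q≰R)) N₀≤N 2N<m+Rm

open import Defs
open import Data.Nat using (ℕ; suc; _≤_; _∸_)
open import Data.Fin using (Fin; fromℕ)
open import Data.Integer using (ℤ; +_; _+_; _-_; _*_; _^_; _>_; _≥_; ∣_∣)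
open import Data.List using (List; length)
open import Data.List.Membership.Propositional using (_∈_)
open import Data.List.Relation.Unary.All as All using (All)
open import Data.List.Relation.Unary.Unique.Propositional using (Unique)
open import Data.Product using (Σ; _×_; _,_; proj₁; proj₂)
open import Relation.Binary.PropositionalEquality using (_≡_; _≢_; refl; sym; trans; cong; subst; module ≡-Reasoning)

import Data.Nat as ℕ
import Data.Nat.Properties as ℕ
open import Data.Nat.DivMod using (_/_; m/n*n≤m)
import Data.Integer as ℤ
import Data.Integer.Properties as ℤ
open import Data.Integer.Tactic.RingSolver using (solve-∀)

open TranslatePigeonhole
open LowerOrderTerms
open SizeEstimates

PolynomialDifferenceIn[A-A] : (k : ℕ) → (Fin (suc k) → ℤ) → List ℕ → Set
PolynomialDifferenceIn[A-A] k a A =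
  Σ ℕ λ r′ → Σ ℕ λ r″ → 1 ≤ r′ × 1 ≤ r″ × r′ ≢ r″ ×
    Σ ℕ λ x → Σ ℕ λ y → x ∈ A × y ∈ A ×
      polyEval (suc k) a (+ r′) - polyEval (suc k) a (+ r″) ≡ (+ x) - (+ y)

i>0⇒i≡+c : ∀ i → i > + 0 → Σ ℕ λ c → i ≡ + c × 1 ≤ c
i>0⇒i≡+c (+ 0) (ℤ.+<+ ())
i>0⇒i≡+c ℤ.+[1+ c ] _ = suc c , refl , ℕ.s≤s ℕ.z≤n

density-ℤ⇒ℕ : ∀ k {a c N m} → a ≡ + c → (+ m) ^ suc k ≥ (+ 4) ^ suc k * a * (+ N) ^ k →
  4 ℕ.^ suc k ℕ.* c ℕ.* N ℕ.^ k ≤ m ℕ.^ suc k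
density-ℤ⇒ℕ k {c = c} {N} {m} refl dense
  rewrite pos-^ 4 (suc k) | pos-^ N k | pos-^ m (suc k)
        | sym (ℤ.pos-* (4 ℕ.^ suc k) c) | sym (ℤ.pos-* (4 ℕ.^ suc k ℕ.* c) (N ℕ.^ k))
  = ℤ.drop‿+≤+ dense

1≤m^[1+k]⇒1≤m : ∀ {m} k → 1 ≤ m ℕ.^ suc k → 1 ≤ m
1≤m^[1+k]⇒1≤m {suc m} k _ = ℕ.s≤s ℕ.z≤n

cancel-shifts : ∀ x y p q e → x + (p + e) ≡ y + (q + e) → p - q ≡ y - x
cancel-shifts x y p q e shifts≡ = begin
  p - q                         ≡⟨ widen x p q e ⟩
  x + (p + e) - (x + (q + e))   ≡⟨ cong (_- (x + (q + e))) shifts≡ ⟩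
  y + (q + e) - (x + (q + e))   ≡⟨ narrow x y q e ⟩
  y - x                         ∎
  where
  open ≡-Reasoning
  widen : ∀ x p q e → p - q ≡ x + (p + e) - (x + (q + e))
  widen = solve-∀
  narrow : ∀ x y q e → y + (q + e) - (x + (q + e)) ≡ y - x
  narrow = solve-∀

dense⇒polynomialDifference : ∀ k (a : Fin (suc (suc k)) → ℤ) {c} → a (fromℕ (suc k)) ≡ + c → 1 ≤ c →
  ∀ {N} → threshold k c (lowerCoeffNorm (suc k) a) ≤ N →
  ∀ {A} → Unique A → All (λ x → 1 ≤ x × x ≤ N) A →
  4 ℕ.^ suc k ℕ.* c ℕ.* N ℕ.^ k ≤ length A ℕ.^ suc k →
  PolynomialDifferenceIn[A-A] (suc k) a A
dense⇒polynomialDifference k a {c} a[k]≡c 1≤c {N} N₀≤N {A} A! A⊆[1…N] dense =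
  conclude (translatesMeet A t A! ([1…]-Unique R) (λ r∈ x∈A → bounded r∈ x∈A) crowded)
  where
  m = length A
  B = lowerCoeffNorm (suc k) a
  instance
    N≢0 : ℕ.NonZero N
    N≢0 = ℕ.>-nonZero (ℕ.≤-trans (ℕ.s≤s ℕ.z≤n) N₀≤N)
    m≢0 : ℕ.NonZero m
    m≢0 = ℕ.>-nonZero (1≤m^[1+k]⇒1≤m k (ℕ.≤-trans 1≤4^[1+k]*c*N^k dense))
      where
      1≤4^[1+k]*c*N^k : 1 ≤ 4 ℕ.^ suc k ℕ.* c ℕ.* N ℕ.^ k
      1≤4^[1+k]*c*N^k = ℕ.*-mono-≤ (ℕ.*-mono-≤ (ℕ.m^n>0 4 (suc k)) 1≤c) (ℕ.m^n>0 N k)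
  R = 2 ℕ.* N / m
  E = B ℕ.* R ℕ.^ k
  P : ℕ → ℤ
  P r = polyEval (suc (suc k)) a (+ r)
  t : ℕ → ℕ
  t r = ∣ P r + + E ∣

  crowded : 1 ℕ.+ (N ℕ.+ offsetSpan k c B R) ℕ.< length [1… R ] ℕ.* m
  crowded = subst (λ L → 1 ℕ.+ (N ℕ.+ offsetSpan k c B R) ℕ.< L ℕ.* m) (sym (length-[1…] R))
    (1+N+span<R*m k {c} {B} {N} {m} {R} 1≤c (2^k*c*R^k≤N k {c} {N} {m} {R} dense (m/n*n≤m (2 ℕ.* N) m))
      (2≤[2*n]/m (Unique∧⊆[1…N]⇒length≤N A! A⊆[1…N])) N₀≤N (n<m+[n/m]*m (2 ℕ.* N) m))

  module _ {r} (r∈ : r ∈ [1… R ]) where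
    T = lowerTerms (suc k) a r
    cr^k = c ℕ.* r ℕ.^ suc k
    ∣T∣≤E : ∣ T ∣ ≤ E
    ∣T∣≤E = lowerTerms-bound-on-[1…R] k a (proj₁ (∈-[1…]⁻ r∈)) (proj₂ (∈-[1…]⁻ r∈))
    P+E≡ : P r + + E ≡ + cr^k + (T + + E)
    P+E≡ = trans (cong (_+ + E) (polyEval-split (suc k) a a[k]≡c r)) (ℤ.+-assoc (+ cr^k) T (+ E))
    lift : ∀ {x} → + (x ℕ.+ t r) ≡ + x + (P r + + E)
    lift {x} = trans (ℤ.pos-+ x (t r)) (cong (_+_ (+ x))
      (ℤ.0≤i⇒+∣i∣≡i (subst (ℤ.0ℤ ℤ.≤_) (sym P+E≡) (0≤n+[i+E] cr^k T E ∣T∣≤E))))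
    t≤span : t r ≤ offsetSpan k c B R
    t≤span = ℕ.≤-trans
      (subst (λ i → ∣ i ∣ ≤ cr^k ℕ.+ (E ℕ.+ E)) (sym P+E≡) (∣n+[i+E]∣≤n+2E cr^k T E ∣T∣≤E))
      (ℕ.+-monoˡ-≤ (E ℕ.+ E) (ℕ.*-monoʳ-≤ c (ℕ.^-monoˡ-≤ (suc k) (proj₂ (∈-[1…]⁻ r∈)))))
    bounded : ∀ {x} → x ∈ A → x ℕ.+ t r ℕ.< 1 ℕ.+ (N ℕ.+ offsetSpan k c B R)
    bounded x∈A = ℕ.s≤s (ℕ.+-mono-≤ (proj₂ (All.lookup A⊆[1…N] x∈A)) t≤span)

  conclude : TranslatesMeet A t [1… R ] → PolynomialDifferenceIn[A-A] (suc k) a A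
  conclude (meet {r′} {r″} {x} {y} r′∈ r″∈ r′≢r″ x∈A y∈A shifts≡) =
    r′ , r″ , proj₁ (∈-[1…]⁻ r′∈) , proj₁ (∈-[1…]⁻ r″∈) , r′≢r″ , y , x , y∈A , x∈A ,
    cancel-shifts (+ x) (+ y) (P r′) (P r″) (+ E) (trans (sym (lift r′∈)) (trans (cong +_ shifts≡) (lift r″∈)))

theorem3p1 : (k : ℕ) → 1 ≤ k → (a : Fin (suc k) → ℤ) → a (fromℕ k) > + 0 →
    Σ ℕ λ N₀ → (N : ℕ) → N₀ ≤ N → (A : List ℕ) → Unique A →
      All (λ x → 1 ≤ x × x ≤ N) A →
      (+ (length A)) ^ k ≥ (+ 4) ^ k * a (fromℕ k) * (+ N) ^ (k ∸ 1) →
      Σ ℕ λ r′ → Σ ℕ λ r″ → 1 ≤ r′ × 1 ≤ r″ × r′ ≢ r″ ×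
        Σ ℕ λ x → Σ ℕ λ y → x ∈ A × y ∈ A ×
          polyEval (suc k) a (+ r′) - polyEval (suc k) a (+ r″) ≡ (+ x) - (+ y)
theorem3p1 (suc k) _ a a[k]>0 with i>0⇒i≡+c (a (fromℕ (suc k))) a[k]>0
... | c , a[k]≡c , 1≤c =
  threshold k c (lowerCoeffNorm (suc k) a) ,
  λ N N₀≤N A A! A⊆[1…N] dense →
    dense⇒polynomialDifference k a a[k]≡c 1≤c N₀≤N A! A⊆[1…N] (density-ℤ⇒ℕ k a[k]≡c dense)
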